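{- For every integer $n\geq 2$, $b_2(G_{3,n})=2$ if $n\equiv 1\pmod 3$, and $b_2(G_{3,n})=1$ otherwise.
   Context: For a graph $G$, a set $D\subseteq V(G)$ is a $2$-dominating set if every vertex not in $D$ has at least $2$ neighbours in $D$. The $2$-domination number $\gamma_2(G)$ is the minimum cardinality of a $2$-dominating set of $G$. The $2$-bondage number $b_2(G)$ is the minimum cardinality of an edge set $B\subseteq E(G)$ such that $\gamma_2(G-B)>\gamma_2(G)$, where $G-B$ has vertex set $V(G)$ and edge set $E(G)\setminus B$. The grid graph $G_{m,n}=P_m\times P_n$ has vertex set $[m]\times[n]$ (where $[k]=\{1,\dots,k\}$), with $(i,j)$ and $(i',j')$ adjacent iff $|i-i'|+|j-j'|=1$. -}

module Defs where

open import Data.Nat using (ℕ; _+_; _<_; _≤_; ∣_-_∣)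
open import Data.Fin using (Fin; toℕ)
open import Data.Product using (_×_; Σ; ∃; ∃-syntax; _,_)
open import Data.Sum using (_⊎_)
open import Data.List using (List; length)
open import Data.List.Membership.Propositional using (_∈_; _∉_)
open import Data.List.Relation.Unary.All using (All)
open import Data.List.Relation.Unary.Unique.Propositional using (Unique)
open import Relation.Binary.PropositionalEquality using (_≡_; _≢_)
open import Relation.Nullary using (¬_)

Graph : Set → Set₁
Graph V = V → V → Set

-- Finite sets of vertices: duplicate-free lists; cardinality = length.
-- D is a 2-dominating set of G: every vertex outside D has at least two
-- (distinct) neighbours in D.
Is2Dominating : {V : Set} → Graph V → List V → Set
Is2Dominating {V} G D =
  (v : V) → v ∉ D →
  Σ V λ u₁ → Σ V λ u₂ →
    u₁ ∈ D × u₂ ∈ D × u₁ ≢ u₂ × G v u₁ × G v u₂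

IsGamma2 : {V : Set} → Graph V → ℕ → Set
IsGamma2 {V} G k =
  (Σ (List V) λ D → Unique D × Is2Dominating G D × length D ≡ k)
  × ((D : List V) → Unique D → Is2Dominating G D → k ≤ length D)

GV : ℕ → ℕ → Set
GV m n = Fin m × Fin n

Grid : (m n : ℕ) → Graph (GV m n)
Grid m n (i , j) (i' , j') = ∣ toℕ i - toℕ i' ∣ + ∣ toℕ j - toℕ j' ∣ ≡ 1

-- Lexicographic strict order on grid vertices, used to give each
-- (undirected) edge a unique canonical representation (u , v) with u < v.
_<lex_ : {m n : ℕ} → GV m n → GV m n → Set
(i , j) <lex (i' , j') = (toℕ i < toℕ i') ⊎ (i ≡ i' × toℕ j < toℕ j')

IsGridEdgeSet : (m n : ℕ) → List (GV m n × GV m n) → Set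
IsGridEdgeSet m n B =
  Unique B × All (λ e → Grid m n (Data.Product.proj₁ e) (Data.Product.proj₂ e)
                        × Data.Product.proj₁ e <lex Data.Product.proj₂ e) B

GridMinus : (m n : ℕ) → List (GV m n × GV m n) → Graph (GV m n)
GridMinus m n B u v = Grid m n u v × ¬ ((u , v) ∈ B ⊎ (v , u) ∈ B)

Increases2 : (m n : ℕ) → List (GV m n × GV m n) → Set
Increases2 m n B =
  (g g' : ℕ) → IsGamma2 (Grid m n) g → IsGamma2 (GridMinus m n B) g' → g < g'

IsBondage2Grid : (m n b : ℕ) → Set
IsBondage2Grid m n b =
  (Σ (List (GV m n × GV m n)) λ B →
     IsGridEdgeSet m n B × length B ≡ b × Increases2 m n B)
  × ((B : List (GV m n × GV m n)) → IsGridEdgeSet m n B →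
       length B < b → ¬ Increases2 m n B)

-- A vertex set of G₃,ₙ is read as its sequence of columns, each a subset of
-- the three rows, and being 2-dominating is a condition on every window of
-- three consecutive columns.  Lower bounds are transfer-matrix bounds: the
-- least weight of a column sequence whose windows are all dominated is
-- computed exactly for up to six columns and then continued periodically, four
-- vertices for every three columns; a finite check that the continuation still
-- obeys the Bellman inequality proves γ₂(G₃,ₙ) ≥ ⌈4n/3⌉, and γ₂ ≥ ⌈4n/3⌉ + 1
-- once the first top edge (for n ≢ 1 mod 3), respectively the first two top
-- edges (for n ≡ 1), are deleted.  A deleted edge only changes the windows
-- containing it.  The repeated pattern of columns (middle, top and bottom,
-- middle) gives matching upper bounds, and for n ≡ 1 three variants of it are
-- minimum and chosen so that every single edge can be deleted while one of
-- them stays 2-dominating.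

module Submission where

open import Defs
open import Data.Bool using (Bool; true; false; _∧_; _∨_; not; if_then_else_; T)
open import Data.Bool.Properties using (T?; T-∧; T-∨; T-≡)
open import Data.Bool.ListAction using (all; any)
open import Data.Empty using (⊥; ⊥-elim)
open import Data.Fin using (Fin; toℕ; fromℕ<) renaming (zero to fzero; suc to fsuc)
open import Data.Fin.Properties using (toℕ<n; toℕ-injective; toℕ-fromℕ<)
open import Data.List using (List; []; _∷_; length; filter; map; drop; _++_; allFin)
open import Data.List.Properties using (length-++; length-map)
open import Data.List.Membership.Propositional using (_∈_)
open import Data.List.Membership.Propositional.Properties
  using (∈-filter⁺; ∈-filter⁻; ∈-map⁺; ∈-map⁻; ∈-++⁺ˡ; ∈-++⁺ʳ; ∈-allFin)
open import Data.List.Relation.Unary.All using (All; []; _∷_)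
import Data.List.Relation.Unary.All as All
open import Data.List.Relation.Unary.All.Properties using (all⁺; all⁻)
open import Data.List.Relation.Unary.Any using (here; there)
import Data.List.Relation.Unary.Any as Any
open import Data.List.Relation.Unary.Any.Properties using (any⁻)
open import Data.List.Relation.Unary.AllPairs using ([]; _∷_)
open import Data.List.Relation.Unary.Unique.Propositional using (Unique)
import Data.List.Relation.Unary.Unique.Propositional.Properties as Unique
open import Data.Nat
  using (ℕ; zero; suc; pred; _+_; _*_; _%_; _/_; _⊓_; _≤_; _<_; _≤ᵇ_; _≡ᵇ_; z≤n; s≤s; ∣_-_∣)
open import Data.Nat.Properties
open import Data.Nat.DivMod using ([m+n]%n≡m%n; [m+kn]%n≡m%n; m≡m%n+[m/n]*n)
open import Data.Nat.ListAction using (sum)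
open import Data.Product using (Σ; ∃; _×_; _,_; proj₁; proj₂)
open import Data.Sum using (_⊎_; inj₁; inj₂)
import Data.Sum as Sum
open import Data.Unit using (⊤; tt)
open import Data.Maybe using (Maybe; just; nothing; fromMaybe; is-nothing)
import Data.Maybe as Maybe
open import Function using (_∘_; const; Equivalence)
open import Relation.Binary.PropositionalEquality hiding ([_])
open import Relation.Nullary using (¬_; Dec; yes; no)
open import Algebra.Properties.CommutativeSemigroup +-commutativeSemigroup
  using (interchange; x∙yz≈y∙xz)

≡ᵇ≡true⇒≡ : ∀ m n → (m ≡ᵇ n) ≡ true → m ≡ n
≡ᵇ≡true⇒≡ m n eq = ≡ᵇ⇒≡ m n (subst T (sym eq) tt)

≡ᵇ-refl : ∀ n → (n ≡ᵇ n) ≡ true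
≡ᵇ-refl n = Equivalence.to T-≡ (≡⇒≡ᵇ n n refl)

≢⇒≡ᵇ≡false : ∀ m n → m ≢ n → (m ≡ᵇ n) ≡ false
≢⇒≡ᵇ≡false m n m≢n with m ≡ᵇ n in eq
... | false = refl
... | true = ⊥-elim (m≢n (≡ᵇ≡true⇒≡ m n eq))

T-⇒ : ∀ b {x} → T (not b ∨ x) → T b → T x
T-⇒ true h _ = h

¬T-not⇒T : ∀ {x} → ¬ T (not x) → T x
¬T-not⇒T {true} _ = tt
¬T-not⇒T {false} h = h tt

two-members⇒2≤length : {A : Set} {x y : A} {xs : List A} →
  x ∈ xs → y ∈ xs → x ≢ y → 2 ≤ length xs
two-members⇒2≤length (here refl) (here refl) x≢y = ⊥-elim (x≢y refl)
two-members⇒2≤length (here _) (there (here _)) _ = s≤s (s≤s z≤n)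
two-members⇒2≤length (here _) (there (there _)) _ = s≤s (s≤s z≤n)
two-members⇒2≤length (there (here _)) (here _) _ = s≤s (s≤s z≤n)
two-members⇒2≤length (there (there _)) (here _) _ = s≤s (s≤s z≤n)
two-members⇒2≤length (there x∈) (there y∈) x≢y = m≤n⇒m≤1+n (two-members⇒2≤length x∈ y∈ x≢y)

2≤length⇒two-members : {A : Set} {xs : List A} → Unique xs → 2 ≤ length xs →
  Σ A λ x → Σ A λ y → x ∈ xs × y ∈ xs × x ≢ y
2≤length⇒two-members {xs = x ∷ y ∷ _} ((x≢y ∷ _) ∷ _) _ = x , y , here refl , there (here refl) , x≢y
2≤length⇒two-members {xs = _ ∷ []} _ (s≤s ())

-- Columns and local domination

record Col : Set where
  constructor col
  field
    top middle bottom : Bool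

empty : Col
empty = col false false false

bit : Col → ℕ → Bool
bit (col x _ _) 0 = x
bit (col _ y _) 1 = y
bit (col _ _ z) 2 = z
bit _ _ = false

bit-empty : ∀ i → bit empty i ≡ false
bit-empty 0 = refl
bit-empty 1 = refl
bit-empty 2 = refl
bit-empty (suc (suc (suc _))) = refl

above : Col → ℕ → Bool
above c zero = false
above c (suc i) = bit c i

count : Bool → ℕ
count true = 1
count false = 0

weight : Col → ℕ
weight (col x y z) = count x + count y + count z

data Dir : Set where
  left right up down : Dir

directions : List Dir
directions = left ∷ right ∷ up ∷ down ∷ []

directions-unique : Unique directions
directions-unique = ((λ ()) ∷ (λ ()) ∷ (λ ()) ∷ []) ∷ ((λ ()) ∷ (λ ()) ∷ []) ∷ ((λ ()) ∷ []) ∷ [] ∷ []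

∈-directions : ∀ d → d ∈ directions
∈-directions left = here refl
∈-directions right = there (here refl)
∈-directions up = there (there (here refl))
∈-directions down = there (there (there (here refl)))

-- A mask records, for each row of a column, which of its four grid edges are
-- still present.
Mask : Set
Mask = ℕ → Dir → Bool

full : Mask
full _ _ = true

-- For the middle column b of three consecutive columns a b c: is the
-- d-neighbour of row i occupied and joined to it under the mask m?
occupiedNeighbour : Mask → Col → Col → Col → ℕ → Dir → Bool
occupiedNeighbour m a b c i left = bit a i ∧ m i left
occupiedNeighbour m a b c i right = bit c i ∧ m i right
occupiedNeighbour m a b c i up = above b i ∧ m i up
occupiedNeighbour m a b c i down = bit b (suc i) ∧ m i down

neighbours : Mask → Col → Col → Col → ℕ → List Dir
neighbours m a b c i = filter (λ d → T? (occupiedNeighbour m a b c i d)) directions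

rowDominated : Mask → Col → Col → Col → ℕ → Bool
rowDominated m a b c i = bit b i ∨ (2 ≤ᵇ length (neighbours m a b c i))

rows : List ℕ
rows = 0 ∷ 1 ∷ 2 ∷ []

row∈ : ∀ {a} → a < 3 → a ∈ rows
row∈ {0} _ = here refl
row∈ {1} _ = there (here refl)
row∈ {2} _ = there (there (here refl))
row∈ {suc (suc (suc _))} (s≤s (s≤s (s≤s ())))

dominated : Mask → Col → Col → Col → Bool
dominated m a b c = all (rowDominated m a b c) rows

dominated⇒rowDominated : ∀ {m a b c} i → i < 3 → T (dominated m a b c) → T (rowDominated m a b c i)
dominated⇒rowDominated {m} {a} {b} {c} i i<3 d = All.lookup (all⁺ (rowDominated m a b c) rows d) (row∈ i<3)

rows⇒dominated : ∀ {m a b c} → (∀ i → i < 3 → T (rowDominated m a b c i)) → T (dominated m a b c)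
rows⇒dominated {m} {a} {b} {c} row =
  all⁻ (rowDominated m a b c) {rows}
    (row 0 (s≤s z≤n) ∷ row 1 (s≤s (s≤s z≤n)) ∷ row 2 (s≤s (s≤s (s≤s z≤n))) ∷ [])

_─[_]→_ : ℕ × ℕ → Dir → ℕ × ℕ → Set
(i , j) ─[ left ]→ (i' , j') = i' ≡ i × suc j' ≡ j
(i , j) ─[ right ]→ (i' , j') = i' ≡ i × j' ≡ suc j
(i , j) ─[ up ]→ (i' , j') = suc i' ≡ i × j' ≡ j
(i , j) ─[ down ]→ (i' , j') = i' ≡ suc i × j' ≡ j

Adjacent : ℕ × ℕ → ℕ × ℕ → Set
Adjacent (i , j) (i' , j') = ∣ i - i' ∣ + ∣ j - j' ∣ ≡ 1

∣m-n∣≡1⇒ : ∀ m n → ∣ m - n ∣ ≡ 1 → suc n ≡ m ⊎ n ≡ suc m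
∣m-n∣≡1⇒ zero (suc n) eq = inj₂ (cong suc (sym (∣m-n∣≡0⇒m≡n (suc-injective eq))))
∣m-n∣≡1⇒ (suc m) zero eq = inj₁ (cong suc (∣m-n∣≡0⇒m≡n (suc-injective eq)))
∣m-n∣≡1⇒ (suc m) (suc n) eq with ∣m-n∣≡1⇒ m n eq
... | inj₁ e = inj₁ (cong suc e)
... | inj₂ e = inj₂ (cong suc e)

∣1+n-n∣≡1 : ∀ n → ∣ suc n - n ∣ ≡ 1
∣1+n-n∣≡1 zero = refl
∣1+n-n∣≡1 (suc n) = ∣1+n-n∣≡1 n

m+n≡1⇒ : ∀ m n → m + n ≡ 1 → (m ≡ 0 × n ≡ 1) ⊎ (m ≡ 1 × n ≡ 0)
m+n≡1⇒ zero n eq = inj₁ (refl , eq)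
m+n≡1⇒ (suc zero) zero eq = inj₂ (refl , refl)

adjacent⇒step : ∀ p q → Adjacent p q → ∃ λ d → p ─[ d ]→ q
adjacent⇒step (i , j) (i' , j') eq with m+n≡1⇒ ∣ i - i' ∣ ∣ j - j' ∣ eq
... | inj₁ (di≡0 , dj≡1) with ∣m-n∣≡0⇒m≡n {i} {i'} di≡0 | ∣m-n∣≡1⇒ j j' dj≡1
...   | refl | inj₁ e = left , refl , e
...   | refl | inj₂ e = right , refl , e
adjacent⇒step (i , j) (i' , j') eq | inj₂ (di≡1 , dj≡0)
  with ∣m-n∣≡0⇒m≡n {j} {j'} dj≡0 | ∣m-n∣≡1⇒ i i' di≡1
...   | refl | inj₁ e = up , e , refl
...   | refl | inj₂ e = down , e , refl

step⇒adjacent : ∀ p q d → p ─[ d ]→ q → Adjacent p q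
step⇒adjacent (i , _) (_ , j') left (refl , refl) = cong₂ _+_ (∣n-n∣≡0 i) (∣1+n-n∣≡1 j')
step⇒adjacent (i , j) _ right (refl , refl) = cong₂ _+_ (∣n-n∣≡0 i) (trans (∣-∣-comm j (suc j)) (∣1+n-n∣≡1 j))
step⇒adjacent (_ , j) (i' , _) up (refl , refl) = cong₂ _+_ (∣1+n-n∣≡1 i') (∣n-n∣≡0 j)
step⇒adjacent (i , j) _ down (refl , refl) = cong₂ _+_ (trans (∣-∣-comm i (suc i)) (∣1+n-n∣≡1 i)) (∣n-n∣≡0 j)

step-target : ∀ p q q' d → p ─[ d ]→ q → p ─[ d ]→ q' → q ≡ q'
step-target _ _ _ left (refl , e) (refl , e') = cong (_ ,_) (suc-injective (trans e (sym e')))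
step-target _ _ _ right (refl , refl) (refl , refl) = refl
step-target _ _ _ up (e , refl) (e' , refl) = cong (_, _) (suc-injective (trans e (sym e')))
step-target _ _ _ down (refl , refl) (refl , refl) = refl

step-direction : ∀ p q d d' → p ─[ d ]→ q → p ─[ d' ]→ q → d ≡ d'
step-direction _ _ left left _ _ = refl
step-direction _ _ right right _ _ = refl
step-direction _ _ up up _ _ = refl
step-direction _ _ down down _ _ = refl
step-direction _ _ left right (refl , refl) (_ , ())
step-direction _ _ left up (refl , refl) (() , _)
step-direction _ _ left down (refl , refl) (() , _)
step-direction _ _ right left (refl , refl) (_ , ())
step-direction _ _ right up (refl , refl) (() , _)
step-direction _ _ right down (refl , refl) (() , _)
step-direction _ _ up left (refl , refl) (() , _)
step-direction _ _ up right (refl , refl) (() , _)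
step-direction _ _ up down (refl , refl) (() , _)
step-direction _ _ down left (refl , refl) (() , _)
step-direction _ _ down right (refl , refl) (() , _)
step-direction _ _ down up (refl , refl) (() , _)

pos : ∀ {n} → GV 3 n → ℕ × ℕ
pos (i , j) = toℕ i , toℕ j

pos-injective : ∀ {n} {v w : GV 3 n} → pos v ≡ pos w → v ≡ w
pos-injective {v = _ , _} {_ , _} eq = cong₂ _,_ (toℕ-injective (cong proj₁ eq)) (toℕ-injective (cong proj₂ eq))

_∨ᶜ_ : Col → Col → Col
col x y z ∨ᶜ col x' y' z' = col (x ∨ x') (y ∨ y') (z ∨ z')

-- The column test comes first, so that cellColumn v t computes to empty
-- beyond the last column.
cellColumn : ∀ {n} → GV 3 n → ℕ → Col
cellColumn (i , j) t = col (cell 0) (cell 1) (cell 2)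
  where cell : ℕ → Bool
        cell r = (toℕ j ≡ᵇ t) ∧ (toℕ i ≡ᵇ r)

column : ∀ {n} → List (GV 3 n) → ℕ → Col
column [] t = empty
column (v ∷ D) t = cellColumn v t ∨ᶜ column D t

-- Column t sits at index suc t, so that window t is centred on column t.
padded : ∀ {n} → List (GV 3 n) → ℕ → Col
padded D zero = empty
padded D (suc t) = column D t

bit-∨ᶜ : ∀ a b i → bit (a ∨ᶜ b) i ≡ bit a i ∨ bit b i
bit-∨ᶜ (col _ _ _) (col _ _ _) 0 = refl
bit-∨ᶜ (col _ _ _) (col _ _ _) 1 = refl
bit-∨ᶜ (col _ _ _) (col _ _ _) 2 = refl
bit-∨ᶜ (col _ _ _) (col _ _ _) (suc (suc (suc _))) = refl

bit-cellColumn : ∀ {n} (v : GV 3 n) → T (bit (cellColumn v (proj₂ (pos v))) (proj₁ (pos v)))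
bit-cellColumn (fzero , j) = Equivalence.from T-∧ (≡⇒≡ᵇ (toℕ j) (toℕ j) refl , tt)
bit-cellColumn (fsuc fzero , j) = Equivalence.from T-∧ (≡⇒≡ᵇ (toℕ j) (toℕ j) refl , tt)
bit-cellColumn (fsuc (fsuc fzero) , j) = Equivalence.from T-∧ (≡⇒≡ᵇ (toℕ j) (toℕ j) refl , tt)

∈⇒bit-column : ∀ {n} {D : List (GV 3 n)} {v} → v ∈ D → T (bit (column D (proj₂ (pos v))) (proj₁ (pos v)))
∈⇒bit-column {D = w ∷ D} {v} (here refl)
  rewrite bit-∨ᶜ (cellColumn w (proj₂ (pos v))) (column D (proj₂ (pos v))) (proj₁ (pos v)) =
  Equivalence.from T-∨ (inj₁ (bit-cellColumn v))
∈⇒bit-column {D = w ∷ D} {v} (there v∈D)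
  rewrite bit-∨ᶜ (cellColumn w (proj₂ (pos v))) (column D (proj₂ (pos v))) (proj₁ (pos v)) =
  Equivalence.from T-∨ (inj₂ (∈⇒bit-column v∈D))

column-beyond : ∀ {n} (D : List (GV 3 n)) t → n ≤ t → column D t ≡ empty
column-beyond [] t _ = refl
column-beyond ((i , j) ∷ D) t n≤t
  rewrite ≢⇒≡ᵇ≡false (toℕ j) t (<⇒≢ (<-≤-trans (toℕ<n j) n≤t)) = column-beyond D t n≤t

Schedule : Set
Schedule = ℕ → Mask

Keeps : ∀ {n} → Schedule → Graph (GV 3 n) → Set
Keeps s H = ∀ v u d → pos v ─[ d ]→ pos u → H v u → T (s (proj₂ (pos v)) (proj₁ (pos v)) d)

occupiedNeighbour-step : ∀ {n} (D : List (GV 3 n)) m i j u d → (i , j) ─[ d ]→ pos u → u ∈ D → T (m i d) →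
  T (occupiedNeighbour m (padded D j) (padded D (suc j)) (padded D (suc (suc j))) i d)
occupiedNeighbour-step D m i j u left (e₁ , e₂) u∈D kept =
  Equivalence.from T-∧ (subst₂ (λ r c → T (bit (padded D c) r)) e₁ e₂ (∈⇒bit-column u∈D) , kept)
occupiedNeighbour-step D m i j u right (e₁ , e₂) u∈D kept =
  Equivalence.from T-∧ (subst₂ (λ r c → T (bit (column D c) r)) e₁ e₂ (∈⇒bit-column u∈D) , kept)
occupiedNeighbour-step D m i j u up (e₁ , e₂) u∈D kept =
  Equivalence.from T-∧ (subst₂ (λ r c → T (above (column D c) r)) e₁ e₂ (∈⇒bit-column u∈D) , kept)
occupiedNeighbour-step D m i j u down (e₁ , e₂) u∈D kept =
  Equivalence.from T-∧ (subst₂ (λ r c → T (bit (column D c) r)) e₁ e₂ (∈⇒bit-column u∈D) , kept)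

vertexDominated : ∀ {n} {H : Graph (GV 3 n)} {s : Schedule} {D : List (GV 3 n)} →
  (∀ v u → H v u → Grid 3 n v u) → Keeps s H → Is2Dominating H D → ∀ v →
  let (i , j) = pos v in T (rowDominated (s j) (padded D j) (padded D (suc j)) (padded D (suc (suc j))) i)
vertexDominated {H = H} {s} {D} H⊆Grid keeps dom v with bit (column D (proj₂ (pos v))) (proj₁ (pos v)) in occ
... | true = tt
... | false with dom v (λ v∈D → subst T occ (∈⇒bit-column v∈D))
...   | u₁ , u₂ , u₁∈D , u₂∈D , u₁≢u₂ , vu₁ , vu₂
  with adjacent⇒step (pos v) (pos u₁) (H⊆Grid v u₁ vu₁) | adjacent⇒step (pos v) (pos u₂) (H⊆Grid v u₂ vu₂)
...   | d₁ , step₁ | d₂ , step₂ =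
  ≤⇒≤ᵇ (two-members⇒2≤length (member d₁ u₁ step₁ u₁∈D vu₁) (member d₂ u₂ step₂ u₂∈D vu₂) d₁≢d₂)
  where
  i = proj₁ (pos v)
  j = proj₂ (pos v)
  a = padded D j
  b = padded D (suc j)
  c = padded D (suc (suc j))
  member : ∀ d u → pos v ─[ d ]→ pos u → u ∈ D → H v u → d ∈ neighbours (s j) a b c i
  member d u step u∈D vu = ∈-filter⁺ (λ d → T? (occupiedNeighbour (s j) a b c i d)) (∈-directions d)
    (occupiedNeighbour-step D (s j) i j u d step u∈D (keeps v u d step vu))
  d₁≢d₂ : d₁ ≢ d₂
  d₁≢d₂ refl = u₁≢u₂ (pos-injective (step-target (pos v) (pos u₁) (pos u₂) d₁ step₁ step₂))

Window : (ℕ → Col) → Mask → ℕ → Set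
Window f m t = T (dominated m (f t) (f (suc t)) (f (suc (suc t))))

columnDominated : ∀ {n} {H : Graph (GV 3 n)} {s : Schedule} {D : List (GV 3 n)} →
  (∀ v u → H v u → Grid 3 n v u) → Keeps s H → Is2Dominating H D →
  ∀ t → t < n → Window (padded D) (s t) t
columnDominated {s = s} {D} H⊆Grid keeps dom t t<n = rows⇒dominated λ i i<3 →
  subst₂ (λ i t → T (rowDominated (s t) (padded D t) (padded D (suc t)) (padded D (suc (suc t))) i))
    (toℕ-fromℕ< i<3) (toℕ-fromℕ< t<n) (vertexDominated {s = s} H⊆Grid keeps dom (fromℕ< i<3 , fromℕ< t<n))

sumFrom : (ℕ → ℕ) → ℕ → ℕ → ℕ
sumFrom f s zero = 0
sumFrom f s (suc l) = f s + sumFrom f (suc s) l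

sumFrom-mono-≤ : ∀ {f g} → (∀ t → f t ≤ g t) → ∀ s l → sumFrom f s l ≤ sumFrom g s l
sumFrom-mono-≤ f≤g s zero = z≤n
sumFrom-mono-≤ f≤g s (suc l) = +-mono-≤ (f≤g s) (sumFrom-mono-≤ f≤g (suc s) l)

sumFrom-+ : ∀ f g s l → sumFrom (λ t → f t + g t) s l ≡ sumFrom f s l + sumFrom g s l
sumFrom-+ f g s zero = refl
sumFrom-+ f g s (suc l) = trans (cong (f s + g s +_) (sumFrom-+ f g (suc s) l))
  (interchange (f s) (g s) (sumFrom f (suc s) l) (sumFrom g (suc s) l))

sumFrom-suc : ∀ f s l → sumFrom (f ∘ suc) s l ≡ sumFrom f (suc s) l
sumFrom-suc f s zero = refl
sumFrom-suc f s (suc l) = cong (f (suc s) +_) (sumFrom-suc f (suc s) l)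

sumFrom-indicator-zero : ∀ c s l → c < s → sumFrom (λ t → count (c ≡ᵇ t)) s l ≡ 0
sumFrom-indicator-zero c s zero _ = refl
sumFrom-indicator-zero c s (suc l) c<s rewrite ≢⇒≡ᵇ≡false c s (<⇒≢ c<s) =
  sumFrom-indicator-zero c (suc s) l (m<n⇒m<1+n c<s)

sumFrom-indicator-≤1 : ∀ c s l → sumFrom (λ t → count (c ≡ᵇ t)) s l ≤ 1
sumFrom-indicator-≤1 c s zero = z≤n
sumFrom-indicator-≤1 c s (suc l) with c ≡ᵇ s in eq
... | false = sumFrom-indicator-≤1 c (suc s) l
... | true rewrite ≡ᵇ≡true⇒≡ c s eq | sumFrom-indicator-zero s (suc s) l ≤-refl = ≤-refl

count-∨ : ∀ x y → count (x ∨ y) ≤ count x + count y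
count-∨ true _ = s≤s z≤n
count-∨ false _ = ≤-refl

weight-∨ᶜ : ∀ a b → weight (a ∨ᶜ b) ≤ weight a + weight b
weight-∨ᶜ (col x y z) (col x' y' z') = begin
  count (x ∨ x') + count (y ∨ y') + count (z ∨ z')
    ≤⟨ +-mono-≤ (+-mono-≤ (count-∨ x x') (count-∨ y y')) (count-∨ z z') ⟩
  (count x + count x') + (count y + count y') + (count z + count z')
    ≡⟨ cong (_+ (count z + count z')) (interchange (count x) (count x') (count y) (count y')) ⟩
  (count x + count y) + (count x' + count y') + (count z + count z')
    ≡⟨ interchange (count x + count y) (count x' + count y') (count z) (count z') ⟩
  weight (col x y z) + weight (col x' y' z') ∎
  where open ≤-Reasoning

weight-cellColumn : ∀ {n} (v : GV 3 n) t → weight (cellColumn v t) ≤ count (proj₂ (pos v) ≡ᵇ t)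
weight-cellColumn (i , j) t with toℕ j ≡ᵇ t
... | false = z≤n
... | true with i
...   | fzero = ≤-refl
...   | fsuc fzero = ≤-refl
...   | fsuc (fsuc fzero) = ≤-refl

columnWeights≤length : ∀ {n} (D : List (GV 3 n)) s l → sumFrom (weight ∘ column D) s l ≤ length D
columnWeights≤length [] s zero = z≤n
columnWeights≤length {n} [] s (suc l) = columnWeights≤length {n} [] (suc s) l
columnWeights≤length (v ∷ D) s l = begin
  sumFrom (weight ∘ column (v ∷ D)) s l
    ≤⟨ sumFrom-mono-≤ (λ t → ≤-trans (weight-∨ᶜ (cellColumn v t) (column D t))
                                     (+-monoˡ-≤ (weight (column D t)) (weight-cellColumn v t))) s l ⟩
  sumFrom (λ t → count (c ≡ᵇ t) + weight (column D t)) s l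
    ≡⟨ sumFrom-+ (λ t → count (c ≡ᵇ t)) (weight ∘ column D) s l ⟩
  sumFrom (λ t → count (c ≡ᵇ t)) s l + sumFrom (weight ∘ column D) s l
    ≤⟨ +-mono-≤ (sumFrom-indicator-≤1 c s l) (columnWeights≤length D s l) ⟩
  suc (length D) ∎
  where
  open ≤-Reasoning
  c = proj₂ (pos v)

-- Transfer-matrix lower bounds

columns : List Col
columns = col false false false ∷ col true false false ∷ col false true false ∷ col true true false ∷
          col false false true ∷ col true false true ∷ col false true true ∷ col true true true ∷ []

∈-columns : ∀ c → c ∈ columns
∈-columns (col false false false) = here refl
∈-columns (col true false false) = there (here refl)
∈-columns (col false true false) = there (there (here refl))
∈-columns (col true true false) = there (there (there (here refl)))
∈-columns (col false false true) = there (there (there (there (here refl))))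
∈-columns (col true false true) = there (there (there (there (there (here refl)))))
∈-columns (col false true true) = there (there (there (there (there (there (here refl))))))
∈-columns (col true true true) = there (there (there (there (there (there (there (here refl)))))))

allColumns : (Col → Bool) → Bool
allColumns p = all p columns

allColumns-sound : ∀ p → T (allColumns p) → ∀ c → T (p c)
allColumns-sound p h c = All.lookup (all⁺ p columns h) (∈-columns c)

-- Nested pairs rather than a function, so that a table is computed once and
-- then shared by all lookups.
ColMap : Set → Set
ColMap A = ((A × A) × (A × A)) × ((A × A) × (A × A))

select : {A : Set} → Bool → A × A → A
select false = proj₁
select true = proj₂

_!_ : {A : Set} → ColMap A → Col → A
t ! col x y z = select x (select y (select z t))

tabulate : {A : Set} → (Col → A) → ColMap A
tabulate f = both λ z → both λ y → both λ x → f (col x y z)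
  where
  both : {B : Set} → (Bool → B) → B × B
  both g = g false , g true

!-tabulate : {A : Set} (f : Col → A) (c : Col) → tabulate f ! c ≡ f c
!-tabulate f (col false false false) = refl
!-tabulate f (col true false false) = refl
!-tabulate f (col false true false) = refl
!-tabulate f (col true true false) = refl
!-tabulate f (col false false true) = refl
!-tabulate f (col true false true) = refl
!-tabulate f (col false true true) = refl
!-tabulate f (col true true true) = refl

ℕ∞ : Set
ℕ∞ = Maybe ℕ

∞ : ℕ∞
∞ = nothing

infix 4 _≤∞_ _≤∞ᵇ_
infixr 6 _+∞_

_≤∞_ : ℕ∞ → ℕ∞ → Set
_ ≤∞ nothing = ⊤
nothing ≤∞ just _ = ⊥
just a ≤∞ just b = a ≤ b

_≤∞ᵇ_ : ℕ∞ → ℕ∞ → Bool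
_ ≤∞ᵇ nothing = true
nothing ≤∞ᵇ just _ = false
just a ≤∞ᵇ just b = a ≤ᵇ b

≤∞ᵇ⇒≤∞ : ∀ x y → T (x ≤∞ᵇ y) → x ≤∞ y
≤∞ᵇ⇒≤∞ _ nothing _ = tt
≤∞ᵇ⇒≤∞ (just a) (just b) h = ≤ᵇ⇒≤ a b h

≤∞-trans : ∀ x y z → x ≤∞ y → y ≤∞ z → x ≤∞ z
≤∞-trans _ _ nothing _ _ = tt
≤∞-trans (just a) (just b) (just c) a≤b b≤c = ≤-trans a≤b b≤c

_+∞_ : ℕ → ℕ∞ → ℕ∞
n +∞ x = Maybe.map (n +_) x

+∞-monoʳ : ∀ n x y → x ≤∞ y → (n +∞ x) ≤∞ (n +∞ y)
+∞-monoʳ n _ nothing _ = tt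
+∞-monoʳ n (just a) (just b) a≤b = +-monoʳ-≤ n a≤b

_⊓∞_ : ℕ∞ → ℕ∞ → ℕ∞
nothing ⊓∞ y = y
just a ⊓∞ nothing = just a
just a ⊓∞ just b = just (a ⊓ b)

⊓∞-lowerˡ : ∀ x y → (x ⊓∞ y) ≤∞ x
⊓∞-lowerˡ nothing _ = tt
⊓∞-lowerˡ (just a) nothing = ≤-refl
⊓∞-lowerˡ (just a) (just b) = m⊓n≤m a b

⊓∞-lowerʳ : ∀ x y → (x ⊓∞ y) ≤∞ y
⊓∞-lowerʳ x nothing = tt
⊓∞-lowerʳ nothing (just b) = ≤-refl
⊓∞-lowerʳ (just a) (just b) = m⊓n≤n a b

minimum∞ : List ℕ∞ → ℕ∞
minimum∞ [] = ∞
minimum∞ (x ∷ xs) = x ⊓∞ minimum∞ xs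

minimum∞-lower : ∀ {x xs} → x ∈ xs → minimum∞ xs ≤∞ x
minimum∞-lower {x} {_ ∷ xs} (here refl) = ⊓∞-lowerˡ x (minimum∞ xs)
minimum∞-lower {x} {y ∷ xs} (there x∈xs) =
  ≤∞-trans (y ⊓∞ minimum∞ xs) (minimum∞ xs) x (⊓∞-lowerʳ y (minimum∞ xs)) (minimum∞-lower x∈xs)

-- t [ p , c ] bounds from below the weight of the columns from c onwards,
-- given that p precedes c; ∞ means that no such columns exist.
Table : Set
Table = ColMap (ColMap ℕ∞)

infix 10 _[_,_]

_[_,_] : Table → Col → Col → ℕ∞
t [ p , c ] = (t ! p) ! c

tabulate² : (Col → Col → ℕ∞) → Table
tabulate² f = tabulate λ p → tabulate λ c → f p c

tabulate²-[,] : ∀ f p c → tabulate² f [ p , c ] ≡ f p c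
tabulate²-[,] f p c = trans (cong (_! c) (!-tabulate (λ p → tabulate (f p)) p)) (!-tabulate (f p) c)

Bellman : Table → Mask → Table → Set
Bellman cur m next = ∀ p c d → T (dominated m p c d) → cur [ p , c ] ≤∞ weight c +∞ (next [ c , d ])

Terminal : Table → Mask → Set
Terminal cur m = ∀ p c → T (dominated m p c empty) → cur [ p , c ] ≤∞ just (weight c)

lastColumnCost : Mask → Table
lastColumnCost m = tabulate² λ p c → if dominated m p c empty then just (weight c) else ∞

viaColumn : Mask → Table → Col → Col → Col → ℕ∞
viaColumn m next p c d = if dominated m p c d then weight c +∞ next [ c , d ] else ∞

extendCost : Mask → Table → Table
extendCost m next = tabulate² λ p c → minimum∞ (map (viaColumn m next p c) columns)

lastColumnCost-terminal : ∀ m → Terminal (lastColumnCost m) m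
lastColumnCost-terminal m p c dom
  rewrite tabulate²-[,] (λ p c → if dominated m p c empty then just (weight c) else ∞) p c
        | Equivalence.to T-≡ dom = ≤-refl

extendCost-bellman : ∀ m next → Bellman (extendCost m next) m next
extendCost-bellman m next p c d dom
  rewrite tabulate²-[,] (λ p c → minimum∞ (map (viaColumn m next p c) columns)) p c =
  subst (minimum∞ (map (viaColumn m next p c) columns) ≤∞_) chosen
    (minimum∞-lower (∈-map⁺ (viaColumn m next p c) (∈-columns d)))
  where
  chosen : viaColumn m next p c d ≡ weight c +∞ next [ c , d ]
  chosen rewrite Equivalence.to T-≡ dom = refl

maskAt : List Mask → Schedule
maskAt [] _ = full
maskAt (m ∷ ms) zero = m
maskAt (m ∷ ms) (suc t) = maskAt ms t

maskAt-suc : ∀ ms t → maskAt ms (suc t) ≡ maskAt (drop 1 ms) t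
maskAt-suc [] t = refl
maskAt-suc (m ∷ ms) t = refl

-- cost ms k [ p , c ] is the least weight of k + 1 columns c , … that are
-- followed by an empty column and whose windows are dominated under ms.
cost : List Mask → ℕ → Table
cost ms zero = lastColumnCost (maskAt ms 0)
cost ms (suc k) = extendCost (maskAt ms 0) (cost (drop 1 ms) k)

add4 : Table → Table
add4 t = tabulate² λ p c → 4 +∞ t [ p , c ]

-- Beyond six columns the exact cost is replaced by its periodic continuation:
-- four more vertices for every three more columns.
bound : List Mask → ℕ → Table
bound ms (suc (suc (suc (suc (suc (suc k)))))) = add4 (bound ms (suc (suc (suc k))))
bound ms k = cost ms k

bellmanAt? : Table → Mask → Table → Col → Col → Col → Bool
bellmanAt? cur m next p c d = not (dominated m p c d) ∨ (cur [ p , c ] ≤∞ᵇ weight c +∞ next [ c , d ])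

bellman? : Table → Mask → Table → Bool
bellman? cur m next = allColumns λ p → allColumns λ c → allColumns (bellmanAt? cur m next p c)

bellman?-sound : ∀ cur m next → T (bellman? cur m next) → Bellman cur m next
bellman?-sound cur m next ok p c d dom =
  ≤∞ᵇ⇒≤∞ (cur [ p , c ]) (weight c +∞ next [ c , d ]) (T-⇒ (dominated m p c d) entry dom)
  where
  entry : T (bellmanAt? cur m next p c d)
  entry = allColumns-sound (bellmanAt? cur m next p c) (allColumns-sound (λ c → allColumns (bellmanAt? cur m next p c))
            (allColumns-sound (λ p → allColumns λ c → allColumns (bellmanAt? cur m next p c)) ok p) c) d

add4-bellman : ∀ cur m next → Bellman cur m next → Bellman (add4 cur) m (add4 next)
add4-bellman cur m next bell p c d dom
  rewrite tabulate²-[,] (λ p c → 4 +∞ cur [ p , c ]) p c | tabulate²-[,] (λ p c → 4 +∞ next [ p , c ]) c d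
  with cur [ p , c ] | next [ c , d ] | bell p c d dom
... | _ | nothing | _ = tt
... | just a | just b | a≤w+b = subst (4 + a ≤_) (x∙yz≈y∙xz 4 (weight c) b) (+-monoʳ-≤ 4 a≤w+b)

Certified : List Mask → Set
Certified ms = ∀ k → Bellman (bound ms (suc k)) (maskAt ms 0) (bound (drop 1 ms) k)

certified : ∀ ms → T (bellman? (bound ms 6) (maskAt ms 0) (bound (drop 1 ms) 5)) → Certified ms
certified ms _ 0 = extendCost-bellman _ _
certified ms _ 1 = extendCost-bellman _ _
certified ms _ 2 = extendCost-bellman _ _
certified ms _ 3 = extendCost-bellman _ _
certified ms _ 4 = extendCost-bellman _ _
certified ms ok 5 = bellman?-sound _ _ _ ok
certified ms ok (suc (suc (suc (suc (suc (suc k)))))) =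
  add4-bellman _ _ _ (certified ms ok (suc (suc (suc k))))

LowerBoundCertificate : List Mask → Set
LowerBoundCertificate [] = Certified []
LowerBoundCertificate (m ∷ ms) = Certified (m ∷ ms) × LowerBoundCertificate ms

certificate-head : ∀ ms → LowerBoundCertificate ms → Certified ms
certificate-head [] cert = cert
certificate-head (m ∷ ms) (cert , _) = cert

certificate-drop : ∀ ms → LowerBoundCertificate ms → LowerBoundCertificate (drop 1 ms)
certificate-drop [] cert = cert
certificate-drop (m ∷ ms) (_ , cert) = cert

bound-lower : ∀ ms → LowerBoundCertificate ms → ∀ k (f : ℕ → Col) →
  (∀ t → t ≤ k → Window f (maskAt ms t) t) → f (suc (suc k)) ≡ empty →
  bound ms k [ f 0 , f 1 ] ≤∞ just (sumFrom (weight ∘ f) 1 (suc k))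
bound-lower ms cert zero f windows end =
  subst (λ w → lastColumnCost (maskAt ms 0) [ f 0 , f 1 ] ≤∞ just w) (sym (+-identityʳ (weight (f 1))))
    (lastColumnCost-terminal (maskAt ms 0) (f 0) (f 1)
      (subst (λ e → T (dominated (maskAt ms 0) (f 0) (f 1) e)) end (windows 0 z≤n)))
bound-lower ms cert (suc k) f windows end =
  ≤∞-trans (bound ms (suc k) [ f 0 , f 1 ]) (weight (f 1) +∞ bound (drop 1 ms) k [ f 1 , f 2 ]) _
    (certificate-head ms cert k (f 0) (f 1) (f 2) (windows 0 z≤n))
    (subst (λ s → weight (f 1) +∞ bound (drop 1 ms) k [ f 1 , f 2 ] ≤∞ just (weight (f 1) + s))
       (sumFrom-suc (weight ∘ f) 1 (suc k)) (+∞-monoʳ (weight (f 1)) _ _ rest-lower))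
  where
  rest-lower : bound (drop 1 ms) k [ f 1 , f 2 ] ≤∞ just (sumFrom (weight ∘ f ∘ suc) 1 (suc k))
  rest-lower = bound-lower (drop 1 ms) (certificate-drop ms cert) k (f ∘ suc)
    (λ t t≤k → subst (λ m → Window f m (suc t)) (maskAt-suc ms t) (windows (suc t) (s≤s t≤k))) end

bound≤∞length : ∀ {k} {H : Graph (GV 3 (suc k))} ms → LowerBoundCertificate ms →
  (∀ v u → H v u → Grid 3 (suc k) v u) → Keeps (maskAt ms) H →
  ∀ D → Is2Dominating H D → bound ms k [ empty , column D 0 ] ≤∞ just (length D)
bound≤∞length {k} ms cert H⊆Grid keeps D dom =
  ≤∞-trans (bound ms k [ empty , column D 0 ]) _ (just (length D))
    (bound-lower ms cert k (padded D) (λ t t≤k → columnDominated H⊆Grid keeps dom t (s≤s t≤k))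
      (column-beyond D (suc k) ≤-refl))
    (subst (_≤ length D) (sumFrom-suc (weight ∘ padded D) 0 (suc k)) (columnWeights≤length D 0 (suc k)))

BelowBound : List Mask → (ℕ → ℕ) → ℕ → Set
BelowBound ms target n = ∀ c → just (target n) ≤∞ bound ms (pred n) [ empty , c ]

belowBound? : List Mask → (ℕ → ℕ) → ℕ → Bool
belowBound? ms target n = allColumns λ c → just (target n) ≤∞ᵇ bound ms (pred n) [ empty , c ]

belowBound?-sound : ∀ ms target n → T (belowBound? ms target n) → BelowBound ms target n
belowBound?-sound ms target n ok c =
  ≤∞ᵇ⇒≤∞ _ _ (allColumns-sound (λ c → just (target n) ≤∞ᵇ bound ms (pred n) [ empty , c ]) ok c)

belowBound-periodic : ∀ ms target (P : ℕ → Set) →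
  (∀ n → target (3 + n) ≡ 4 + target n) → (∀ n → P (3 + n) → P n) →
  All (λ n → P n → T (belowBound? ms target n)) (2 ∷ 3 ∷ 4 ∷ 5 ∷ 6 ∷ []) →
  ∀ n → 2 ≤ n → P n → BelowBound ms target n
belowBound-periodic ms target P _ _ _ 1 (s≤s ()) _
belowBound-periodic ms target P _ _ (ok ∷ _) 2 _ p = belowBound?-sound ms target 2 (ok p)
belowBound-periodic ms target P _ _ (_ ∷ ok ∷ _) 3 _ p = belowBound?-sound ms target 3 (ok p)
belowBound-periodic ms target P _ _ (_ ∷ _ ∷ ok ∷ _) 4 _ p = belowBound?-sound ms target 4 (ok p)
belowBound-periodic ms target P _ _ (_ ∷ _ ∷ _ ∷ ok ∷ _) 5 _ p = belowBound?-sound ms target 5 (ok p)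
belowBound-periodic ms target P _ _ (_ ∷ _ ∷ _ ∷ _ ∷ ok ∷ _) 6 _ p = belowBound?-sound ms target 6 (ok p)
belowBound-periodic ms target P period P-period base (suc (suc (suc m@(suc (suc (suc (suc k))))))) _ p c =
  subst₂ _≤∞_ (cong just (sym (period m)))
    (sym (tabulate²-[,] (λ p c → 4 +∞ bound ms (suc (suc (suc k))) [ p , c ]) empty c))
    (+∞-monoʳ 4 (just (target m)) _
      (belowBound-periodic ms target P period P-period base m (s≤s (s≤s z≤n)) (P-period m p) c))

lowerBound : ∀ {k} {H : Graph (GV 3 (suc k))} ms target → LowerBoundCertificate ms →
  (∀ v u → H v u → Grid 3 (suc k) v u) → Keeps (maskAt ms) H → BelowBound ms target (suc k) →
  ∀ D → Is2Dominating H D → target (suc k) ≤ length D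
lowerBound {k} ms target cert H⊆Grid keeps below D dom =
  ≤∞-trans (just (target (suc k))) (bound ms k [ empty , column D 0 ]) (just (length D))
    (below (column D 0)) (bound≤∞length ms cert H⊆Grid keeps D dom)

-- 2-dominating sets from words of columns

columnAt : List Col → ℕ → Col
columnAt [] _ = empty
columnAt (c ∷ W) zero = c
columnAt (c ∷ W) (suc t) = columnAt W t

framed : List Col → ℕ → Col
framed W = columnAt (empty ∷ W)

weightSum : List Col → ℕ
weightSum W = sum (map weight W)

cellsOf : ∀ {n} → Col → List (GV 3 (suc n))
cellsOf c = map (_, fzero) (filter (λ i → T? (bit c (toℕ i))) (allFin 3))

shift : ∀ {n} → GV 3 n → GV 3 (suc n)
shift (i , j) = i , fsuc j

cells : ∀ {n} → List Col → List (GV 3 n)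
cells {zero} _ = []
cells {suc n} [] = []
cells {suc n} (c ∷ W) = cellsOf c ++ map shift (cells W)

length-cellsOf : ∀ {n} c → length (cellsOf {n} c) ≡ weight c
length-cellsOf (col false false false) = refl
length-cellsOf (col true false false) = refl
length-cellsOf (col false true false) = refl
length-cellsOf (col true true false) = refl
length-cellsOf (col false false true) = refl
length-cellsOf (col true false true) = refl
length-cellsOf (col false true true) = refl
length-cellsOf (col true true true) = refl

length-cells : ∀ {n} W → length (cells {n} W) ≤ weightSum W
length-cells {zero} W = z≤n
length-cells {suc n} [] = z≤n
length-cells {suc n} (c ∷ W) rewrite length-++ (cellsOf {n} c) {map shift (cells {n} W)}
  | length-map shift (cells {n} W) | length-cellsOf {n} c = +-monoʳ-≤ (weight c) (length-cells {n} W)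

cells-unique : ∀ {n} W → Unique (cells {n} W)
cells-unique {zero} W = []
cells-unique {suc n} [] = []
cells-unique {suc n} (c ∷ W) =
  Unique.++⁺ (Unique.map⁺ (cong proj₁) (Unique.filter⁺ (λ i → T? (bit c (toℕ i))) (Unique.allFin⁺ 3)))
             (Unique.map⁺ shift-injective (cells-unique {n} W)) disjoint
  where
  shift-injective : ∀ {v w} → shift {n} v ≡ shift w → v ≡ w
  shift-injective {_ , _} {_ , _} refl = refl
  disjoint : ∀ {v} → ¬ (v ∈ cellsOf c × v ∈ map shift (cells W))
  disjoint (v∈c , v∈W) with ∈-map⁻ (_, fzero) v∈c | ∈-map⁻ shift v∈W
  ... | _ , _ , refl | (_ , _) , _ , ()

∈-cells : ∀ {n} W (v : GV 3 n) → T (bit (columnAt W (proj₂ (pos v))) (proj₁ (pos v))) → v ∈ cells W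
∈-cells [] v occupied = ⊥-elim (subst T (bit-empty (proj₁ (pos v))) occupied)
∈-cells (c ∷ W) (i , fzero) occupied =
  ∈-++⁺ˡ (∈-map⁺ (_, fzero) (∈-filter⁺ (λ i → T? (bit c (toℕ i))) (∈-allFin i) occupied))
∈-cells (c ∷ W) (i , fsuc j) occupied = ∈-++⁺ʳ (cellsOf c) (∈-map⁺ shift (∈-cells W (i , j) occupied))

bit-bound : ∀ c k → T (bit c k) → k < 3
bit-bound c 0 _ = s≤s z≤n
bit-bound c 1 _ = s≤s (s≤s z≤n)
bit-bound c 2 _ = s≤s (s≤s (s≤s z≤n))

columnAt-bound : ∀ W t r → T (bit (columnAt W t) r) → t < length W
columnAt-bound [] t r h = ⊥-elim (subst T (bit-empty r) h)
columnAt-bound (c ∷ W) zero r h = s≤s z≤n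
columnAt-bound (c ∷ W) (suc t) r h = s≤s (columnAt-bound W t r h)

vertexAt : ∀ {n} W → length W ≡ n → ∀ r t → T (bit (columnAt W t) r) →
  Σ (GV 3 n) λ u → pos u ≡ (r , t) × u ∈ cells W
vertexAt W refl r t h = u , pos-u , ∈-cells W u (subst (λ p → T (bit (columnAt W (proj₂ p)) (proj₁ p))) (sym pos-u) h)
  where
  r<3 = bit-bound (columnAt W t) r h
  t<n = columnAt-bound W t r h
  u = fromℕ< r<3 , fromℕ< t<n
  pos-u : pos u ≡ (r , t)
  pos-u = cong₂ _,_ (toℕ-fromℕ< r<3) (toℕ-fromℕ< t<n)

neighbourVertex : ∀ {n} W → length W ≡ n → ∀ m i j d →
  T (occupiedNeighbour m (framed W j) (framed W (suc j)) (framed W (suc (suc j))) i d) →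
  Σ (GV 3 n) λ u → (i , j) ─[ d ]→ pos u × u ∈ cells W × T (m i d)
neighbourVertex W lenW m i zero left h = ⊥-elim (subst T (bit-empty i) (proj₁ (Equivalence.to T-∧ h)))
neighbourVertex W lenW m i (suc j) left h with Equivalence.to T-∧ h
... | occupied , kept with vertexAt W lenW i j occupied
...   | u , at , u∈W = u , (cong proj₁ at , cong (suc ∘ proj₂) at) , u∈W , kept
neighbourVertex W lenW m i j right h with Equivalence.to T-∧ h
... | occupied , kept with vertexAt W lenW i (suc j) occupied
...   | u , at , u∈W = u , (cong proj₁ at , cong proj₂ at) , u∈W , kept
neighbourVertex W lenW m (suc i) j up h with Equivalence.to T-∧ h
... | occupied , kept with vertexAt W lenW i j occupied
...   | u , at , u∈W = u , (cong (suc ∘ proj₁) at , cong proj₂ at) , u∈W , kept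
neighbourVertex W lenW m i j down h with Equivalence.to T-∧ h
... | occupied , kept with vertexAt W lenW (suc i) j occupied
...   | u , at , u∈W = u , (cong proj₁ at , cong proj₂ at) , u∈W , kept

KeepsOnly : ∀ {n} → Schedule → Graph (GV 3 n) → Set
KeepsOnly s H = ∀ v u d → pos v ─[ d ]→ pos u → T (s (proj₂ (pos v)) (proj₁ (pos v)) d) → H v u

ValidWord : Schedule → List Col → Set
ValidWord s W = ∀ t → t < length W → Window (framed W) (s t) t

cells-dominating : ∀ {n} {H : Graph (GV 3 n)} s W → length W ≡ n → KeepsOnly s H → ValidWord s W →
  Is2Dominating H (cells W)
cells-dominating {n} {H} s W lenW keepsOnly valid v v∉W =
  Sum.[ (λ occupied → ⊥-elim (v∉W (∈-cells W v occupied))) , twoNeighbours ] (Equivalence.to T-∨ row)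
  where
  i = proj₁ (pos v)
  j = proj₂ (pos v)
  a = framed W j
  b = framed W (suc j)
  c = framed W (suc (suc j))
  occupied? : ∀ d → Dec (T (occupiedNeighbour (s j) a b c i d))
  occupied? d = T? (occupiedNeighbour (s j) a b c i d)
  row : T (rowDominated (s j) a b c i)
  row = dominated⇒rowDominated i (toℕ<n (proj₁ v)) (valid j (subst (j <_) (sym lenW) (toℕ<n (proj₂ v))))
  neighbour : ∀ {d} → d ∈ neighbours (s j) a b c i →
    Σ (GV 3 n) λ u → pos v ─[ d ]→ pos u × u ∈ cells W × H v u
  neighbour {d} d∈
    with neighbourVertex W lenW (s j) i j d (proj₂ (∈-filter⁻ occupied? {xs = directions} d∈))
  ... | u , step , u∈W , kept = u , step , u∈W , keepsOnly v u d step kept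
  twoNeighbours : T (2 ≤ᵇ length (neighbours (s j) a b c i)) →
    Σ (GV 3 n) λ u₁ → Σ (GV 3 n) λ u₂ → u₁ ∈ cells W × u₂ ∈ cells W × u₁ ≢ u₂ × H v u₁ × H v u₂
  twoNeighbours two
    with 2≤length⇒two-members (Unique.filter⁺ occupied? directions-unique) (≤ᵇ⇒≤ 2 _ two)
  ... | d₁ , d₂ , d₁∈ , d₂∈ , d₁≢d₂ with neighbour d₁∈ | neighbour d₂∈
  ...   | u₁ , step₁ , u₁∈W , vu₁ | u₂ , step₂ , u₂∈W , vu₂ =
    u₁ , u₂ , u₁∈W , u₂∈W , (λ { refl → d₁≢d₂ (step-direction (pos v) (pos u₁) d₁ d₂ step₁ step₂) }) ,
    vu₁ , vu₂

-- Deleting single edges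

index : Dir → ℕ
index left = 0
index right = 1
index up = 2
index down = 3

index-injective : ∀ d e → index d ≡ index e → d ≡ e
index-injective d e eq = trans (sym (fromIndex-index d)) (trans (cong fromIndex eq) (fromIndex-index e))
  where
  fromIndex : ℕ → Dir
  fromIndex 0 = left
  fromIndex 1 = right
  fromIndex 2 = up
  fromIndex _ = down
  fromIndex-index : ∀ d → fromIndex (index d) ≡ d
  fromIndex-index left = refl
  fromIndex-index right = refl
  fromIndex-index up = refl
  fromIndex-index down = refl

without : ℕ → Dir → Mask
without a d i e = not ((i ≡ᵇ a) ∧ (index e ≡ᵇ index d))

_∩_ : Mask → Mask → Mask
(m ∩ m') i d = m i d ∧ m' i d

without-self : ∀ a d → ¬ T (without a d a d)
without-self a d rewrite ≡ᵇ-refl a | ≡ᵇ-refl (index d) = λ ()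

without-cut : ∀ a d i e → ¬ T (without a d i e) → i ≡ a × e ≡ d
without-cut a d i e h with Equivalence.to T-∧ (¬T-not⇒T h)
... | i≡ᵇa , e≡ᵇd = ≡ᵇ⇒≡ i a i≡ᵇa , index-injective e d (≡ᵇ⇒≡ (index e) (index d) e≡ᵇd)

-- s removes exactly the edge between p and q, which lies in direction d from p
-- and in direction d' from q.
Cuts : Schedule → ℕ × ℕ → Dir → ℕ × ℕ → Dir → Set
Cuts s p d q d' =
  (∀ i t e → ¬ T (s t i e) → ((i , t) ≡ p × e ≡ d) ⊎ ((i , t) ≡ q × e ≡ d')) ×
  ¬ T (s (proj₂ p) (proj₁ p) d) × ¬ T (s (proj₂ q) (proj₁ q) d')

cutRight : ℕ → ℕ → Schedule
cutRight a c t = if t ≡ᵇ c then without a right else if t ≡ᵇ suc c then without a left else full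

cutDown : ℕ → ℕ → Schedule
cutDown a c t = if t ≡ᵇ c then without a down ∩ without (suc a) up else full

cutRight-cuts : ∀ a c → Cuts (cutRight a c) (a , c) right (a , suc c) left
cutRight-cuts a c = located , atLeft , atRight
  where
  located : ∀ i t e → ¬ T (cutRight a c t i e) →
    ((i , t) ≡ (a , c) × e ≡ right) ⊎ ((i , t) ≡ (a , suc c) × e ≡ left)
  located i t e h with t ≡ᵇ c in t≡ᵇc
  ... | true = let i≡a , e≡d = without-cut a right i e h in
    inj₁ (cong₂ _,_ i≡a (≡ᵇ≡true⇒≡ t c t≡ᵇc) , e≡d)
  ... | false with t ≡ᵇ suc c in t≡ᵇ1+c
  ...   | true = let i≡a , e≡d = without-cut a left i e h in
    inj₂ (cong₂ _,_ i≡a (≡ᵇ≡true⇒≡ t (suc c) t≡ᵇ1+c) , e≡d)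
  ...   | false = ⊥-elim (h tt)
  atLeft : ¬ T (cutRight a c c a right)
  atLeft rewrite ≡ᵇ-refl c = without-self a right
  atRight : ¬ T (cutRight a c (suc c) a left)
  atRight rewrite ≢⇒≡ᵇ≡false (suc c) c 1+n≢n | ≡ᵇ-refl c = without-self a left

cutDown-cuts : ∀ a c → Cuts (cutDown a c) (a , c) down (suc a , c) up
cutDown-cuts a c = located , atTop , atBottom
  where
  located : ∀ i t e → ¬ T (cutDown a c t i e) →
    ((i , t) ≡ (a , c) × e ≡ down) ⊎ ((i , t) ≡ (suc a , c) × e ≡ up)
  located i t e h with t ≡ᵇ c in t≡ᵇc | T? (without a down i e)
  ... | false | _ = ⊥-elim (h tt)
  ... | true | no kept = let i≡a , e≡d = without-cut a down i e kept in
    inj₁ (cong₂ _,_ i≡a (≡ᵇ≡true⇒≡ t c t≡ᵇc) , e≡d)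
  ... | true | yes kept = let i≡a , e≡d = without-cut (suc a) up i e (h ∘ Equivalence.from T-∧ ∘ (kept ,_)) in
    inj₂ (cong₂ _,_ i≡a (≡ᵇ≡true⇒≡ t c t≡ᵇc) , e≡d)
  atTop : ¬ T (cutDown a c c a down)
  atTop rewrite ≡ᵇ-refl c = without-self a down ∘ proj₁ ∘ Equivalence.to T-∧
  atBottom : ¬ T (cutDown a c c (suc a) up)
  atBottom rewrite ≡ᵇ-refl c = without-self (suc a) up ∘ proj₂ ∘ Equivalence.to T-∧

cut-keeps : ∀ {n} {s} {v₀ u₀ : GV 3 n} {d d'} → pos v₀ ─[ d ]→ pos u₀ → pos u₀ ─[ d' ]→ pos v₀ →
  Cuts s (pos v₀) d (pos u₀) d' → Keeps s (GridMinus 3 n ((v₀ , u₀) ∷ []))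
cut-keeps {s = s} {v₀} {u₀} {d} {d'} v₀u₀ u₀v₀ (located , _ , _) v u e step (_ , uncut)
  with T? (s (proj₂ (pos v)) (proj₁ (pos v)) e)
... | yes kept = kept
... | no removed with located _ _ e removed
...   | inj₁ (v≈v₀ , refl) = ⊥-elim (uncut (inj₁ (here (cong₂ _,_ (pos-injective v≈v₀) (pos-injective u≈u₀)))))
  where
  u≈u₀ : pos u ≡ pos u₀
  u≈u₀ = step-target (pos v₀) (pos u) (pos u₀) d (subst (λ p → p ─[ d ]→ pos u) v≈v₀ step) v₀u₀
...   | inj₂ (v≈u₀ , refl) = ⊥-elim (uncut (inj₂ (here (cong₂ _,_ (pos-injective u≈v₀) (pos-injective v≈u₀)))))
  where
  u≈v₀ : pos u ≡ pos v₀
  u≈v₀ = step-target (pos u₀) (pos u) (pos v₀) d' (subst (λ p → p ─[ d' ]→ pos u) v≈u₀ step) u₀v₀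

cut-keepsOnly : ∀ {n} {s} {v₀ u₀ : GV 3 n} {d d'} → pos v₀ ─[ d ]→ pos u₀ → pos u₀ ─[ d' ]→ pos v₀ →
  Cuts s (pos v₀) d (pos u₀) d' → KeepsOnly s (GridMinus 3 n ((v₀ , u₀) ∷ []))
cut-keepsOnly {s = s} {v₀} {u₀} {d} {d'} v₀u₀ u₀v₀ (_ , cut , cut') v u e step kept =
  step⇒adjacent (pos v) (pos u) e step , uncut
  where
  uncut : ¬ ((v , u) ∈ ((v₀ , u₀) ∷ []) ⊎ (u , v) ∈ ((v₀ , u₀) ∷ []))
  uncut (inj₁ (here refl)) =
    cut (subst (λ e → T (s (proj₂ (pos v₀)) (proj₁ (pos v₀)) e)) (step-direction _ _ e d step v₀u₀) kept)
  uncut (inj₂ (here refl)) =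
    cut' (subst (λ e → T (s (proj₂ (pos u₀)) (proj₁ (pos u₀)) e)) (step-direction _ _ e d' step u₀v₀) kept)

canonical-step : ∀ {n} (v u : GV 3 n) → Grid 3 n v u → v <lex u →
  pos v ─[ right ]→ pos u ⊎ pos v ─[ down ]→ pos u
canonical-step v u adj v<u with adjacent⇒step (pos v) (pos u) adj | v<u
... | right , step | _ = inj₁ step
... | down , step | _ = inj₂ step
... | left , (same , _) | inj₁ row< = ⊥-elim (<-irrefl (sym same) row<)
... | left , (_ , col>) | inj₂ (_ , col<) = ⊥-elim (<-asym col< (subst (toℕ (proj₂ u) <_) col> (n<1+n _)))
... | up , (row> , _) | inj₁ row< = ⊥-elim (<-asym row< (subst (toℕ (proj₁ u) <_) row> (n<1+n _)))
... | up , (row> , _) | inj₂ (refl , _) = ⊥-elim (1+n≢n row>)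

Keeps-mono : ∀ {n} {H : Graph (GV 3 n)} {s s' : Schedule} →
  (∀ t i d → T (s t i d) → T (s' t i d)) → Keeps s H → Keeps s' H
Keeps-mono s⊆s' keeps v u d step vu = s⊆s' _ _ d (keeps v u d step vu)

Keeps-∷ : ∀ {n} {s s' : Schedule} e B → Keeps s (GridMinus 3 n (e ∷ [])) → Keeps s' (GridMinus 3 n B) →
  Keeps (λ t i d → s t i d ∧ s' t i d) (GridMinus 3 n (e ∷ B))
Keeps-∷ e B keeps keeps' v u d step (adj , uncut) = Equivalence.from T-∧
  (keeps v u d step (adj , uncut ∘ Sum.map ∈-head ∈-head) , keeps' v u d step (adj , uncut ∘ Sum.map there there))
  where
  ∈-head : ∀ {x} → x ∈ (e ∷ []) → x ∈ (e ∷ B)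
  ∈-head (here refl) = here refl

cutRight-cases : ∀ a c t → (t ≡ c × cutRight a c t ≡ without a right) ⊎
  (t ≡ suc c × cutRight a c t ≡ without a left) ⊎ cutRight a c t ≡ full
cutRight-cases a c t with t ≡ᵇ c in t≡ᵇc
... | true = inj₁ (≡ᵇ≡true⇒≡ t c t≡ᵇc , refl)
... | false with t ≡ᵇ suc c in t≡ᵇ1+c
...   | true = inj₂ (inj₁ (≡ᵇ≡true⇒≡ t (suc c) t≡ᵇ1+c , refl))
...   | false = inj₂ (inj₂ refl)

cutDown-cases : ∀ a c t → (t ≡ c × cutDown a c t ≡ without a down ∩ without (suc a) up) ⊎ cutDown a c t ≡ full
cutDown-cases a c t with t ≡ᵇ c in t≡ᵇc
... | true = inj₁ (≡ᵇ≡true⇒≡ t c t≡ᵇc , refl)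
... | false = inj₂ refl

window-resched : ∀ {f} {m m' : Mask} {t t'} → m ≡ m' → t ≡ t' → Window f m t → Window f m' t'
window-resched refl refl w = w

cutRight-valid : ∀ a c W → ValidWord (const full) W →
  Window (framed W) (without a right) c → Window (framed W) (without a left) (suc c) → ValidWord (cutRight a c) W
cutRight-valid a c W valid atLeft atRight t t< =
  Sum.[ (λ (t≡c , m≡) → window-resched {framed W} (sym m≡) (sym t≡c) atLeft) ,
  Sum.[ (λ (t≡1+c , m≡) → window-resched {framed W} (sym m≡) (sym t≡1+c) atRight) ,
    (λ m≡ → window-resched {framed W} (sym m≡) refl (valid t t<)) ]′ ]′ (cutRight-cases a c t)

cutDown-valid : ∀ a c W → ValidWord (const full) W →
  Window (framed W) (without a down ∩ without (suc a) up) c → ValidWord (cutDown a c) W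
cutDown-valid a c W valid atCut t t< = Sum.[ (λ (t≡c , m≡) → window-resched {framed W} (sym m≡) (sym t≡c) atCut) ,
  (λ m≡ → window-resched {framed W} (sym m≡) refl (valid t t<)) ]′ (cutDown-cases a c t)

_!?_ : {A : Set} → List (Maybe A) → ℕ → Maybe A
[] !? _ = nothing
(w ∷ ws) !? zero = w
(w ∷ ws) !? suc t = ws !? t

slots : {A : Set} → List A → ℕ → Maybe A
slots xs = (nothing ∷ map just xs) !?_

module _ {A : Set} (P : Maybe A → Maybe A → Maybe A → Maybe A → Bool) where

  -- P on the windows that start at w₀ and read w₁ , w₂ , xs , nothing , nothing
  scan : Maybe A → Maybe A → Maybe A → List A → Bool
  scan w₀ w₁ w₂ [] = P w₀ w₁ w₂ nothing ∧ P w₁ w₂ nothing nothing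
  scan w₀ w₁ w₂ (x ∷ xs) = P w₀ w₁ w₂ (just x) ∧ scan w₁ w₂ (just x) xs

  everyWindow? : List A → Bool
  everyWindow? (x ∷ y ∷ xs) = scan nothing (just x) (just y) xs
  everyWindow? _ = false

  EveryWindow : List A → Set
  EveryWindow xs = ∀ t → t < length xs →
    T (P (slots xs t) (slots xs (suc t)) (slots xs (suc (suc t))) (slots xs (suc (suc (suc t)))))

  scan-sound : ∀ w₀ w₁ w₂ xs → T (scan w₀ w₁ w₂ xs) → ∀ t → t < 2 + length xs →
    let σ = (w₀ ∷ w₁ ∷ w₂ ∷ map just xs) !?_ in
    T (P (σ t) (σ (suc t)) (σ (suc (suc t))) (σ (suc (suc (suc t)))))
  scan-sound w₀ w₁ w₂ [] ok 0 _ = proj₁ (Equivalence.to T-∧ ok)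
  scan-sound w₀ w₁ w₂ [] ok 1 _ = proj₂ (Equivalence.to T-∧ ok)
  scan-sound w₀ w₁ w₂ [] ok (suc (suc t)) (s≤s (s≤s ()))
  scan-sound w₀ w₁ w₂ (x ∷ xs) ok 0 _ = proj₁ (Equivalence.to T-∧ ok)
  scan-sound w₀ w₁ w₂ (x ∷ xs) ok (suc t) (s≤s t<) =
    scan-sound w₁ w₂ (just x) xs (proj₂ (Equivalence.to T-∧ ok)) t t<

  everyWindow?-sound : ∀ xs → T (everyWindow? xs) → EveryWindow xs
  everyWindow?-sound (x ∷ y ∷ xs) ok = scan-sound nothing (just x) (just y) xs ok

slots-framed : ∀ W t → fromMaybe empty (slots W t) ≡ framed W t
slots-framed W zero = refl
slots-framed W (suc t) = at W t
  where
  at : ∀ W t → fromMaybe empty (map just W !? t) ≡ columnAt W t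
  at [] t = refl
  at (c ∷ W) zero = refl
  at (c ∷ W) (suc t) = at W t

slots-map : {A B : Set} (f : A → B) → ∀ xs t → Maybe.map f (slots xs t) ≡ slots (map f xs) t
slots-map f xs zero = refl
slots-map f xs (suc t) = at xs t
  where
  at : ∀ xs t → Maybe.map f (map just xs !? t) ≡ map just (map f xs) !? t
  at [] t = refl
  at (x ∷ xs) zero = refl
  at (x ∷ xs) (suc t) = at xs t

dominatedWindow : Mask → Maybe Col → Maybe Col → Maybe Col → Bool
dominatedWindow m w₀ w₁ w₂ = dominated m (fromMaybe empty w₀) (fromMaybe empty w₁) (fromMaybe empty w₂)

cong₃ : ∀ {A B C D : Set} (f : A → B → C → D) {a a' b b' c c'} →
  a ≡ a' → b ≡ b' → c ≡ c' → f a b c ≡ f a' b' c'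
cong₃ f refl refl refl = refl

window-framed : ∀ m W t → T (dominatedWindow m (slots W t) (slots W (suc t)) (slots W (suc (suc t)))) →
  Window (framed W) m t
window-framed m W t =
  subst T (cong₃ (dominated m) (slots-framed W t) (slots-framed W (suc t)) (slots-framed W (suc (suc t))))

mid ends : Col
mid = col false true false
ends = col true false true

-- γ n = ⌈4n/3⌉
γ : ℕ → ℕ
γ 0 = 0
γ 1 = 2
γ 2 = 3
γ (suc (suc (suc n))) = 4 + γ n

stripes : ℕ → List Col
stripes 0 = []
stripes 1 = ends ∷ []
stripes 2 = mid ∷ ends ∷ []
stripes (suc (suc (suc n))) = mid ∷ ends ∷ mid ∷ stripes n

length-stripes : ∀ n → length (stripes n) ≡ n
length-stripes 0 = refl
length-stripes 1 = refl
length-stripes 2 = refl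
length-stripes (suc (suc (suc n))) = cong (3 +_) (length-stripes n)

weightSum-stripes : ∀ n → weightSum (stripes n) ≡ γ n
weightSum-stripes 0 = refl
weightSum-stripes 1 = refl
weightSum-stripes 2 = refl
weightSum-stripes (suc (suc (suc n))) = cong (4 +_) (weightSum-stripes n)

stripesWindow : Maybe Col → Maybe Col → Maybe Col → Maybe Col → Bool
stripesWindow w₀ w₁ w₂ _ = dominatedWindow full w₀ w₁ w₂

stripes-windows : ∀ n → 2 ≤ n → EveryWindow stripesWindow (stripes n)
stripes-windows n 2≤n = everyWindow?-sound stripesWindow (stripes n) (check n 2≤n)
  where
  periodic : ∀ n → T (scan stripesWindow (just mid) (just ends) (just mid) (stripes n))
  periodic 0 = tt
  periodic 1 = tt
  periodic 2 = tt
  periodic (suc (suc (suc n))) = periodic n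
  check : ∀ n → 2 ≤ n → T (everyWindow? stripesWindow (stripes n))
  check 1 (s≤s ())
  check 2 _ = tt
  check (suc (suc (suc n))) _ = periodic n

stripes-valid : ∀ n → 2 ≤ n → ValidWord (const full) (stripes n)
stripes-valid n 2≤n t t< = window-framed full (stripes n) t (stripes-windows n 2≤n t t<)

-- Minimum sets that survive the deletion of any edge (n ≡ 1 mod 3)

Triple : Set
Triple = Col × Col × Col

component : Fin 3 → Triple → Col
component fzero (x , _ , _) = x
component (fsuc fzero) (_ , y , _) = y
component (fsuc (fsuc fzero)) (_ , _ , z) = z

tripleTail : ℕ → List Triple
tripleTail zero = (mid , ends , mid) ∷ (ends , mid , ends) ∷ []
tripleTail (suc k) = (mid , ends , mid) ∷ (mid , mid , ends) ∷ (ends , mid , mid) ∷ tripleTail k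

-- The components are (m e m)ᵏ⁺¹ e, e (m e m)ᵏ⁺¹ and e (m m e)ᵏ⁺¹, where
-- m = mid and e = ends.
robustTriple : ℕ → List Triple
robustTriple k = (mid , ends , ends) ∷ (ends , mid , mid) ∷ tripleTail k

robustWord : Fin 3 → ℕ → List Col
robustWord i k = map (component i) (robustTriple k)

pick : Fin 3 → Maybe Triple → Col
pick i w = fromMaybe empty (Maybe.map (component i) w)

survivesRight : ℕ → Col → Col → Col → Col → Bool
survivesRight a x₀ x₁ x₂ x₃ = dominated (without a right) x₀ x₁ x₂ ∧ dominated (without a left) x₁ x₂ x₃

survivesDown : ℕ → Col → Col → Col → Bool
survivesDown a x₀ x₁ x₂ = dominated (without a down ∩ without (suc a) up) x₀ x₁ x₂

validAt : Maybe Triple → Maybe Triple → Maybe Triple → Fin 3 → Bool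
validAt w₀ w₁ w₂ i = dominated full (pick i w₀) (pick i w₁) (pick i w₂)

survivesRightAt : Maybe Triple → Maybe Triple → Maybe Triple → Maybe Triple → ℕ → Fin 3 → Bool
survivesRightAt w₀ w₁ w₂ w₃ a i = survivesRight a (pick i w₀) (pick i w₁) (pick i w₂) (pick i w₃)

survivesDownAt : Maybe Triple → Maybe Triple → Maybe Triple → ℕ → Fin 3 → Bool
survivesDownAt w₀ w₁ w₂ a i = survivesDown a (pick i w₀) (pick i w₁) (pick i w₂)

-- w₂ = nothing exactly when the window is centred on the last column, which has
-- no edge to the right.
rightRobustAt : Maybe Triple → Maybe Triple → Maybe Triple → Maybe Triple → ℕ → Bool
rightRobustAt w₀ w₁ w₂ w₃ a = is-nothing w₂ ∨ any (survivesRightAt w₀ w₁ w₂ w₃ a) (allFin 3)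

downRobustAt : Maybe Triple → Maybe Triple → Maybe Triple → ℕ → Bool
downRobustAt w₀ w₁ w₂ a = any (survivesDownAt w₀ w₁ w₂ a) (allFin 3)

validTriple? : Maybe Triple → Maybe Triple → Maybe Triple → Bool
validTriple? w₀ w₁ w₂ = all (validAt w₀ w₁ w₂) (allFin 3)

rightRobust? : Maybe Triple → Maybe Triple → Maybe Triple → Maybe Triple → Bool
rightRobust? w₀ w₁ w₂ w₃ = all (rightRobustAt w₀ w₁ w₂ w₃) rows

downRobust? : Maybe Triple → Maybe Triple → Maybe Triple → Bool
downRobust? w₀ w₁ w₂ = all (downRobustAt w₀ w₁ w₂) (0 ∷ 1 ∷ [])

robustWindow : Maybe Triple → Maybe Triple → Maybe Triple → Maybe Triple → Bool
robustWindow w₀ w₁ w₂ w₃ = validTriple? w₀ w₁ w₂ ∧ (rightRobust? w₀ w₁ w₂ w₃ ∧ downRobust? w₀ w₁ w₂)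

robustTriple-windows : ∀ k → EveryWindow robustWindow (robustTriple k)
robustTriple-windows k = everyWindow?-sound robustWindow (robustTriple k) (check k)
  where
  periodic : ∀ k →
    T (scan robustWindow (just (mid , ends , mid)) (just (mid , mid , ends)) (just (ends , mid , mid)) (tripleTail k))
  periodic zero = tt
  periodic (suc k) = periodic k
  check : ∀ k → T (everyWindow? robustWindow (robustTriple k))
  check zero = tt
  check (suc k) = periodic k

length-robustTriple : ∀ k → length (robustTriple k) ≡ 4 + k * 3
length-robustTriple k = cong (2 +_) (length-tripleTail k)
  where
  length-tripleTail : ∀ k → length (tripleTail k) ≡ 2 + k * 3
  length-tripleTail zero = refl
  length-tripleTail (suc k) = cong (3 +_) (length-tripleTail k)

length-robustWord : ∀ i k → length (robustWord i k) ≡ 4 + k * 3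
length-robustWord i k = trans (length-map (component i) (robustTriple k)) (length-robustTriple k)

weightSum-robustWord : ∀ i k → weightSum (robustWord i k) ≡ γ (4 + k * 3)
weightSum-robustWord fzero zero = refl
weightSum-robustWord fzero (suc k) = cong (4 +_) (weightSum-robustWord fzero k)
weightSum-robustWord (fsuc fzero) zero = refl
weightSum-robustWord (fsuc fzero) (suc k) = cong (4 +_) (weightSum-robustWord (fsuc fzero) k)
weightSum-robustWord (fsuc (fsuc fzero)) zero = refl
weightSum-robustWord (fsuc (fsuc fzero)) (suc k) = cong (4 +_) (weightSum-robustWord (fsuc (fsuc fzero)) k)

pick-framed : ∀ i Z t → pick i (slots Z t) ≡ framed (map (component i) Z) t
pick-framed i Z t = trans (cong (fromMaybe empty) (slots-map (component i) Z t)) (slots-framed (map (component i) Z) t)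

component-window : ∀ m i Z t →
  T (dominated m (pick i (slots Z t)) (pick i (slots Z (suc t))) (pick i (slots Z (suc (suc t))))) →
  Window (framed (map (component i) Z)) m t
component-window m i Z t =
  subst T (cong₃ (dominated m) (pick-framed i Z t) (pick-framed i Z (suc t)) (pick-framed i Z (suc (suc t))))

slots-inside : {A : Set} (xs : List A) (t : ℕ) → t < length xs → ¬ T (is-nothing (slots xs (suc t)))
slots-inside (x ∷ xs) zero _ ()
slots-inside (x ∷ xs) (suc t) (s≤s t<) = slots-inside xs t t<

upperRow∈ : ∀ {a} → suc a < 3 → a ∈ (0 ∷ 1 ∷ [])
upperRow∈ {0} _ = here refl
upperRow∈ {1} _ = there (here refl)
upperRow∈ {suc (suc _)} (s≤s (s≤s (s≤s ())))

record Robust (w₀ w₁ w₂ w₃ : Maybe Triple) : Set where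
  field
    valid : ∀ i → T (validAt w₀ w₁ w₂ i)
    horizontal : ∀ a → a < 3 → ¬ T (is-nothing w₂) → ∃ λ i → T (survivesRightAt w₀ w₁ w₂ w₃ a i)
    vertical : ∀ a → suc a < 3 → ∃ λ i → T (survivesDownAt w₀ w₁ w₂ a i)

robustWindow-sound : ∀ w₀ w₁ w₂ w₃ → T (robustWindow w₀ w₁ w₂ w₃) → Robust w₀ w₁ w₂ w₃
robustWindow-sound w₀ w₁ w₂ w₃ robust = record { valid = valid ; horizontal = horizontal ; vertical = vertical }
  where
  parts = Equivalence.to (T-∧ {validTriple? w₀ w₁ w₂}) robust
  robust' = Equivalence.to (T-∧ {rightRobust? w₀ w₁ w₂ w₃}) (proj₂ parts)
  valid : ∀ i → T (validAt w₀ w₁ w₂ i)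
  valid i = All.lookup (all⁺ (validAt w₀ w₁ w₂) (allFin 3) (proj₁ parts)) (∈-allFin i)
  horizontal : ∀ a → a < 3 → ¬ T (is-nothing w₂) → ∃ λ i → T (survivesRightAt w₀ w₁ w₂ w₃ a i)
  horizontal a a<3 inside =
    Sum.[ (λ last → ⊥-elim (inside last)) ,
          (λ some → Any.satisfied (any⁻ (survivesRightAt w₀ w₁ w₂ w₃ a) (allFin 3) some)) ]
      (Equivalence.to (T-∨ {is-nothing w₂})
        (All.lookup (all⁺ (rightRobustAt w₀ w₁ w₂ w₃) rows (proj₁ robust')) (row∈ a<3)))
  vertical : ∀ a → suc a < 3 → ∃ λ i → T (survivesDownAt w₀ w₁ w₂ a i)
  vertical a a+1<3 = Any.satisfied (any⁻ (survivesDownAt w₀ w₁ w₂ a) (allFin 3)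
    (All.lookup (all⁺ (downRobustAt w₀ w₁ w₂) (0 ∷ 1 ∷ []) (proj₂ robust')) (upperRow∈ a+1<3)))

robustAt : ∀ k t → t < 4 + k * 3 →
  let σ = slots (robustTriple k) in Robust (σ t) (σ (suc t)) (σ (suc (suc t))) (σ (suc (suc (suc t))))
robustAt k t t< = robustWindow-sound (σ t) (σ (suc t)) (σ (suc (suc t))) (σ (suc (suc (suc t))))
  (robustTriple-windows k t (subst (t <_) (sym (length-robustTriple k)) t<))
  where σ = slots (robustTriple k)

robustWord-valid : ∀ i k → ValidWord (const full) (robustWord i k)
robustWord-valid i k t t< = component-window full i (robustTriple k) t
  (Robust.valid (robustAt k t (subst (t <_) (length-robustWord i k) t<)) i)

survivingRight : ∀ k a c → a < 3 → suc c < 4 + k * 3 → Σ (Fin 3) λ i →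
  Window (framed (robustWord i k)) (without a right) c × Window (framed (robustWord i k)) (without a left) (suc c)
survivingRight k a c a<3 c+1< =
  i , component-window (without a right) i (robustTriple k) c (proj₁ halves) ,
      component-window (without a left) i (robustTriple k) (suc c) (proj₂ halves)
  where
  σ = slots (robustTriple k)
  found = Robust.horizontal (robustAt k c (<-trans (n<1+n c) c+1<)) a a<3
            (slots-inside (robustTriple k) (suc c) (subst (suc c <_) (sym (length-robustTriple k)) c+1<))
  i = proj₁ found
  halves = Equivalence.to
    (T-∧ {dominated (without a right) (pick i (σ c)) (pick i (σ (suc c))) (pick i (σ (suc (suc c))))}) (proj₂ found)

survivingDown : ∀ k a c → suc a < 3 → c < 4 + k * 3 → Σ (Fin 3) λ i →
  Window (framed (robustWord i k)) (without a down ∩ without (suc a) up) c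
survivingDown k a c a+1<3 c< =
  proj₁ found , component-window (without a down ∩ without (suc a) up) (proj₁ found) (robustTriple k) c (proj₂ found)
  where found = Robust.vertical (robustAt k c c<) a a+1<3

GridMinus⊆Grid : ∀ {n} B (v u : GV 3 n) → GridMinus 3 n B v u → Grid 3 n v u
GridMinus⊆Grid B v u = proj₁

dominating-mono : ∀ {n} {H H' : Graph (GV 3 n)} → (∀ v u → H v u → H' v u) →
  ∀ D → Is2Dominating H D → Is2Dominating H' D
dominating-mono H⊆H' D dom v v∉D with dom v v∉D
... | u₁ , u₂ , u₁∈D , u₂∈D , u₁≢u₂ , vu₁ , vu₂ =
  u₁ , u₂ , u₁∈D , u₂∈D , u₁≢u₂ , H⊆H' v u₁ vu₁ , H⊆H' v u₂ vu₂

grid-keeps : ∀ {n} → Keeps (const full) (Grid 3 n)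
grid-keeps _ _ _ _ _ = tt

grid-keepsOnly : ∀ {n} → KeepsOnly (const full) (Grid 3 n)
grid-keepsOnly v u d step _ = step⇒adjacent (pos v) (pos u) d step

gridMinus[]-keepsOnly : ∀ {n} → KeepsOnly (const full) (GridMinus 3 n [])
gridMinus[]-keepsOnly v u d step _ = step⇒adjacent (pos v) (pos u) d step , λ { (inj₁ ()) ; (inj₂ ()) }

fullCertificate : Certified []
fullCertificate = certified [] tt

leftCutCertificate : Certified (without 0 left ∷ [])
leftCutCertificate = certified (without 0 left ∷ []) tt

firstEdgeMasks : List Mask
firstEdgeMasks = without 0 right ∷ without 0 left ∷ []

firstEdgeCertificate : LowerBoundCertificate firstEdgeMasks
firstEdgeCertificate = certified firstEdgeMasks tt , leftCutCertificate , fullCertificate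

firstTwoEdgesMasks : List Mask
firstTwoEdgesMasks = without 0 right ∷ (without 0 left ∩ without 0 right) ∷ without 0 left ∷ []

firstTwoEdgesCertificate : LowerBoundCertificate firstTwoEdgesMasks
firstTwoEdgesCertificate =
  certified firstTwoEdgesMasks tt , certified (drop 1 firstTwoEdgesMasks) tt , leftCutCertificate , fullCertificate

grid-lower : ∀ n → 2 ≤ n → ∀ D → Is2Dominating (Grid 3 n) D → γ n ≤ length D
grid-lower (suc k) (s≤s 1≤k) = lowerBound [] γ fullCertificate (λ _ _ adj → adj) grid-keeps
  (belowBound-periodic [] γ (λ _ → ⊤) (λ _ → refl) (λ _ _ → tt)
    ((λ _ → tt) ∷ (λ _ → tt) ∷ (λ _ → tt) ∷ (λ _ → tt) ∷ (λ _ → tt) ∷ []) (suc k) (s≤s 1≤k) tt)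

SmallDominatingSet : ∀ {n} → Graph (GV 3 n) → ℕ → Set
SmallDominatingSet {n} H b = Σ (List (GV 3 n)) λ D → Unique D × Is2Dominating H D × length D ≤ b

isGamma2-γ : ∀ n → 2 ≤ n → ∀ {H : Graph (GV 3 n)} → (∀ v u → H v u → Grid 3 n v u) →
  SmallDominatingSet H (γ n) → IsGamma2 H (γ n)
isGamma2-γ n 2≤n {H} H⊆Grid (D , unique , dom , |D|≤γ) =
  (D , unique , dom , ≤-antisym |D|≤γ (lower D dom)) , λ D' _ dom' → lower D' dom'
  where
  lower : ∀ D → Is2Dominating H D → γ n ≤ length D
  lower D dom = grid-lower n 2≤n D (dominating-mono H⊆Grid D dom)

wordSet : ∀ {n} {H : Graph (GV 3 n)} s W → length W ≡ n → weightSum W ≡ γ n → KeepsOnly s H → ValidWord s W →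
  SmallDominatingSet H (γ n)
wordSet {n} s W lenW weightW keepsOnly valid =
  cells W , cells-unique W , cells-dominating s W lenW keepsOnly valid ,
  subst (length (cells {n} W) ≤_) weightW (length-cells {n} W)

stripedSet : ∀ n → 2 ≤ n → ∀ {H : Graph (GV 3 n)} → KeepsOnly (const full) H →
  SmallDominatingSet H (γ n)
stripedSet n 2≤n keepsOnly =
  wordSet (const full) (stripes n) (length-stripes n) (weightSum-stripes n) keepsOnly (stripes-valid n 2≤n)

no-increase : ∀ n → 2 ≤ n → ∀ B → IsGamma2 (GridMinus 3 n B) (γ n) → ¬ Increases2 3 n B
no-increase n 2≤n B γ-B increase =
  <-irrefl refl (increase (γ n) (γ n) (isGamma2-γ n 2≤n (λ _ _ adj → adj) (stripedSet n 2≤n grid-keepsOnly)) γ-B)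

nothing-deleted : ∀ n → 2 ≤ n → ¬ Increases2 3 n []
nothing-deleted n 2≤n =
  no-increase n 2≤n [] (isGamma2-γ n 2≤n (GridMinus⊆Grid []) (stripedSet n 2≤n gridMinus[]-keepsOnly))

increases : ∀ n → 2 ≤ n → ∀ B →
  (∀ D → Is2Dominating (GridMinus 3 n B) D → suc (γ n) ≤ length D) → Increases2 3 n B
increases n 2≤n B lower g g' (_ , g-minimal) ((D , _ , dom , |D|≡g') , _) with stripedSet n 2≤n grid-keepsOnly
... | S , unique , domS , |S|≤γ =
  ≤-<-trans (≤-trans (g-minimal S unique domS) |S|≤γ) (subst (suc (γ n) ≤_) |D|≡g' (lower D dom))

mod3-period : ∀ n → (3 + n) % 3 ≡ n % 3
mod3-period n = trans (cong (_% 3) (+-comm 3 n)) ([m+n]%n≡m%n n 3)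

bondage-one : ∀ n → 2 ≤ n → n % 3 ≢ 1 → IsBondage2Grid 3 n 1
bondage-one n@(suc (suc m)) 2≤n n≢1 = (B , edgeSet , refl , increases n 2≤n B lower) , minimal
  where
  v₀ u₀ : GV 3 n
  v₀ = fzero , fzero
  u₀ = fzero , fsuc fzero
  B = (v₀ , u₀) ∷ []
  edgeSet : IsGridEdgeSet 3 n B
  edgeSet = [] ∷ [] , (refl , inj₂ (refl , s≤s z≤n)) ∷ []
  keeps : Keeps (maskAt firstEdgeMasks) (GridMinus 3 n B)
  keeps = Keeps-mono {s = cutRight 0 0} {maskAt firstEdgeMasks}
    (λ { 0 _ _ h → h ; 1 _ _ h → h ; (suc (suc _)) _ _ h → h })
    (cut-keeps {v₀ = v₀} {u₀} (refl , refl) (refl , refl) (cutRight-cuts 0 0))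
  lower : ∀ D → Is2Dominating (GridMinus 3 n B) D → suc (γ n) ≤ length D
  lower = lowerBound firstEdgeMasks (suc ∘ γ) firstEdgeCertificate (GridMinus⊆Grid B) keeps
    (belowBound-periodic firstEdgeMasks (suc ∘ γ) (λ n → n % 3 ≢ 1) (λ _ → refl)
      (λ n h → h ∘ trans (mod3-period n))
      ((λ _ → tt) ∷ (λ _ → tt) ∷ (λ 4≢1 → ⊥-elim (4≢1 refl)) ∷ (λ _ → tt) ∷ (λ _ → tt) ∷ [])
      n 2≤n n≢1)
  minimal : ∀ B → IsGridEdgeSet 3 n B → length B < 1 → ¬ Increases2 3 n B
  minimal [] _ _ = nothing-deleted n 2≤n
  minimal (_ ∷ _) _ (s≤s ())
bondage-one 1 (s≤s ())

robustSet : ∀ k (v u : GV 3 (4 + k * 3)) → Grid 3 (4 + k * 3) v u → v <lex u →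
  SmallDominatingSet (GridMinus 3 (4 + k * 3) ((v , u) ∷ [])) (γ (4 + k * 3))
robustSet k v u adj v<u with canonical-step v u adj v<u
... | inj₁ (same-row , next-col) =
  wordSet (cutRight a c) (robustWord i k) (length-robustWord i k) (weightSum-robustWord i k)
    (cut-keepsOnly (same-row , next-col) (sym same-row , sym next-col)
      (subst (λ q → Cuts (cutRight a c) (a , c) right q left) (cong₂ _,_ (sym same-row) (sym next-col))
        (cutRight-cuts a c)))
    (cutRight-valid a c (robustWord i k) (robustWord-valid i k) (proj₁ windows) (proj₂ windows))
  where
  a = proj₁ (pos v)
  c = proj₂ (pos v)
  found = survivingRight k a c (toℕ<n (proj₁ v)) (subst (_< 4 + k * 3) next-col (toℕ<n (proj₂ u)))
  i = proj₁ found
  windows = proj₂ found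
... | inj₂ (next-row , same-col) =
  wordSet (cutDown a c) (robustWord i k) (length-robustWord i k) (weightSum-robustWord i k)
    (cut-keepsOnly (next-row , same-col) (sym next-row , sym same-col)
      (subst (λ q → Cuts (cutDown a c) (a , c) down q up) (cong₂ _,_ (sym next-row) (sym same-col))
        (cutDown-cuts a c)))
    (cutDown-valid a c (robustWord i k) (robustWord-valid i k) window)
  where
  a = proj₁ (pos v)
  c = proj₂ (pos v)
  found = survivingDown k a c (subst (_< 3) next-row (toℕ<n (proj₁ u))) (toℕ<n (proj₂ v))
  i = proj₁ found
  window = proj₂ found

bondage-two : ∀ k → IsBondage2Grid 3 (4 + k * 3) 2
bondage-two k = (B , edgeSet , refl , increases n 2≤n B lower) , minimal
  where
  n = 4 + k * 3
  2≤n : 2 ≤ n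
  2≤n = s≤s (s≤s z≤n)
  v₀ u₀ w₀ : GV 3 n
  v₀ = fzero , fzero
  u₀ = fzero , fsuc fzero
  w₀ = fzero , fsuc (fsuc fzero)
  B = (v₀ , u₀) ∷ (u₀ , w₀) ∷ []
  edgeSet : IsGridEdgeSet 3 n B
  edgeSet = ((λ ()) ∷ []) ∷ [] ∷ [] ,
            (refl , inj₂ (refl , s≤s z≤n)) ∷ (refl , inj₂ (refl , s≤s (s≤s z≤n))) ∷ []
  keeps : Keeps (maskAt firstTwoEdgesMasks) (GridMinus 3 n B)
  keeps = Keeps-mono {s = λ t i d → cutRight 0 0 t i d ∧ cutRight 0 1 t i d} {maskAt firstTwoEdgesMasks}
    (λ { 0 _ _ h → proj₁ (Equivalence.to T-∧ h) ; 1 _ _ h → h ; 2 _ _ h → h ; (suc (suc (suc _))) _ _ h → h })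
    (Keeps-∷ {s = cutRight 0 0} {cutRight 0 1} (v₀ , u₀) ((u₀ , w₀) ∷ [])
      (cut-keeps {v₀ = v₀} {u₀} (refl , refl) (refl , refl) (cutRight-cuts 0 0))
      (cut-keeps {v₀ = u₀} {w₀} (refl , refl) (refl , refl) (cutRight-cuts 0 1)))
  lower : ∀ D → Is2Dominating (GridMinus 3 n B) D → suc (γ n) ≤ length D
  lower = lowerBound firstTwoEdgesMasks (suc ∘ γ) firstTwoEdgesCertificate (GridMinus⊆Grid B) keeps
    (belowBound-periodic firstTwoEdgesMasks (suc ∘ γ) (λ n → n % 3 ≡ 1) (λ _ → refl)
      (λ n → trans (sym (mod3-period n)))
      ((λ ()) ∷ (λ ()) ∷ (λ _ → tt) ∷ (λ ()) ∷ (λ ()) ∷ []) n 2≤n ([m+kn]%n≡m%n 4 k 3))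
  minimal : ∀ B → IsGridEdgeSet 3 n B → length B < 2 → ¬ Increases2 3 n B
  minimal [] _ _ = nothing-deleted n 2≤n
  minimal ((v , u) ∷ []) (_ , (adj , v<u) ∷ []) _ =
    no-increase n 2≤n _ (isGamma2-γ n 2≤n (GridMinus⊆Grid _) (robustSet k v u adj v<u))
  minimal (_ ∷ _ ∷ _) _ (s≤s (s≤s ()))

n%3≡1⇒n≡4+k*3 : ∀ n → 2 ≤ n → n % 3 ≡ 1 → ∃ λ k → n ≡ 4 + k * 3
n%3≡1⇒n≡4+k*3 n 2≤n n%3≡1 with n / 3 | m≡m%n+[m/n]*n n 3
... | zero | n≡ = ⊥-elim (<-irrefl (sym (trans n≡ (trans (+-identityʳ (n % 3)) n%3≡1))) 2≤n)
... | suc k | n≡ = k , trans n≡ (cong (_+ suc k * 3) n%3≡1)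

theorem3 : (n : ℕ) → 2 ≤ n →
    (n % 3 ≡ 1 → IsBondage2Grid 3 n 2) × (n % 3 ≢ 1 → IsBondage2Grid 3 n 1)
theorem3 n 2≤n = two , bondage-one n 2≤n
  where
  two : n % 3 ≡ 1 → IsBondage2Grid 3 n 2
  two n%3≡1 with n%3≡1⇒n≡4+k*3 n 2≤n n%3≡1
  ... | k , refl = bondage-two k
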